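{- Let $n$ be a positive integer, let $u, v \in \Sigma^\star$, and let $r$ be an $n$-ranker that is defined on both $u$ and $v$, i.e. $r \in R_n(u) \cap R_n(v)$. Consider the game $\mathrm{FO}^2_n(u,v)$ starting from a configuration (with arbitrary initial positions of the $y$-pebbles) in which $\mathrm{ord}(x^u, r(u)) \neq \mathrm{ord}(x^v, r(v))$. Then Samson has a winning strategy in this game.
   Context: $\Sigma$ is a finite alphabet and $\Sigma^\star$ the set of finite words over it; for $w=w_1\cdots w_{|w|}$, positions are $1,\dots,|w|$. A boundary position is a symbol $d_{\mathtt a}$ with $d\in\{\triangleright,\triangleleft\}$ and $\mathtt a\in\Sigma$. Its interpretation on $w$ is $\triangleright_{\mathtt a}(w)=\min\{i\in[1,|w|]: w_i=\mathtt a\}$ and $\triangleleft_{\mathtt a}(w)=\max\{i\in[1,|w|]: w_i=\mathtt a\}$; relative to a position $q$: $\triangleright_{\mathtt a}(w,q)=\min\{i\in[q+1,|w|]: w_i=\mathtt a\}$, $\triangleleft_{\mathtt a}(w,q)=\max\{i\in[1,q-1]: w_i=\mathtt a\}$ (min/max of the empty set is undefined). An $n$-ranker is a sequence $r=(p_1,\dots,p_n)$ of $n$ boundary positions, interpreted by $r(w)=p_1(w)$ if $n=1$, $r(w)$ undefined if $(p_1,\dots,p_{n-1})(w)$ is undefined, and otherwise $r(w)=p_n(w,(p_1,\dots,p_{n-1})(w))$. $R_n(w)$ is the set of $n$-rankers defined on $w$. For integers $i,j$, $\mathrm{ord}(i,j)\in\{<,=,>\}$ is the order type of $i$ and $j$.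 The Ehrenfeucht–Fraïssé game $\mathrm{FO}^2_n(u,v)$: there are two pebble pairs $x,y$, with pebbles $x^u,y^u$ on positions of $u$ and $x^v,y^v$ on positions of $v$. The game lasts $n$ moves; in each move Samson picks one of the pairs $x$ or $y$ and places its pebble on a position of one of the two words, and Delilah then places the mate pebble on a position of the other word. Samson wins if, initially or after some move, the map $x^u\mapsto x^v$, $y^u\mapsto y^v$ is not an isomorphism of the induced substructures (i.e. the letters at corresponding pebbled positions differ, or the equality/order relation between the two pebbles differs); otherwise Delilah wins. -}

module Defs where

open import Data.Nat using (ℕ; zero; suc; _∸_; _≤_; _<ᵇ_; _≡ᵇ_)
open import Data.Fin using (Fin) renaming (_≟_ to _≟ᶠ_)
open import Data.List using (List; []; _∷_; length)
open import Data.Vec using (Vec; []; _∷_; toList)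
open import Data.Maybe using (Maybe; just; nothing; _>>=_)
open import Data.Bool using (Bool; true; false; if_then_else_)
open import Data.Product using (_×_; _,_)
open import Relation.Nullary using (¬_)
open import Relation.Nullary.Decidable using (⌊_⌋)
open import Relation.Binary.PropositionalEquality using (_≡_)

Word : ℕ → Set
Word k = List (Fin k)

-- letter at 1-based position i (nothing if i ∉ [1,|w|])
at : ∀ {k} → Word k → ℕ → Maybe (Fin k)
at []      _             = nothing
at (a ∷ w) zero          = nothing
at (a ∷ w) (suc zero)    = just a
at (a ∷ w) (suc (suc i)) = at w (suc i)

isA : ∀ {k} → Word k → Fin k → ℕ → Bool
isA w a i with at w i
... | nothing = false
... | just b  = ⌊ b ≟ᶠ a ⌋

findUp : (ℕ → Bool) → ℕ → ℕ → Maybe ℕ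
findUp P i zero    = nothing
findUp P i (suc c) = if P i then just i else findUp P (suc i) c

findDown : (ℕ → Bool) → ℕ → Maybe ℕ
findDown P zero    = nothing
findDown P (suc j) = if P (suc j) then just (suc j) else findDown P j

data Dir : Set where
  ▷ ◁ : Dir

Boundary : ℕ → Set
Boundary k = Dir × Fin k

absB : ∀ {k} → Word k → Boundary k → Maybe ℕ
absB w (▷ , a) = findUp (isA w a) 1 (length w)
absB w (◁ , a) = findDown (isA w a) (length w)

relB : ∀ {k} → Word k → Boundary k → ℕ → Maybe ℕ
relB w (▷ , a) q = findUp (isA w a) (suc q) (length w ∸ q)
relB w (◁ , a) q = findDown (isA w a) (q ∸ 1)

Ranker : ℕ → ℕ → Set
Ranker k n = Vec (Boundary k) n

evalFrom : ∀ {k} → Word k → ℕ → List (Boundary k) → Maybe ℕ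
evalFrom w q []       = just q
evalFrom w q (p ∷ ps) = relB w p q >>= λ q' → evalFrom w q' ps

-- r(w); undefined (nothing) for the empty sequence
evalRanker : ∀ {k n} → Word k → Ranker k n → Maybe ℕ
evalRanker w []       = nothing
evalRanker w (p ∷ ps) = absB w p >>= λ q → evalFrom w q (toList ps)

data Ord3 : Set where
  lt eq gt : Ord3

ord : ℕ → ℕ → Ord3
ord i j = if i <ᵇ j then lt else (if i ≡ᵇ j then eq else gt)

ValidPos : ∀ {k} → Word k → ℕ → Set
ValidPos w p = (1 ≤ p) × (p ≤ length w)

record Config : Set where
  constructor config
  field
    xu yu xv yv : ℕ
open Config public

ValidConfig : ∀ {k} → Word k → Word k → Config → Set
ValidConfig u v c = ValidPos u (xu c) × ValidPos u (yu c) × ValidPos v (xv c) × ValidPos v (yv c)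

-- the map x^u ↦ x^v, y^u ↦ y^v is an isomorphism of the induced substructures
Iso : ∀ {k} → Word k → Word k → Config → Set
Iso u v c = (at u (xu c) ≡ at v (xv c)) × (at u (yu c) ≡ at v (yv c))
          × (ord (xu c) (yu c) ≡ ord (xv c) (yv c))

data Pebble : Set where
  pX pY : Pebble

place : Pebble → ℕ → ℕ → Config → Config
place pX p q c = config p (yu c) q (yv c)
place pY p q c = config (xu c) p (xv c) q

data SamsonWins {k} (u v : Word k) : ℕ → Config → Set where
  now   : ∀ {m c} → ¬ Iso u v c → SamsonWins u v m c
  moveU : ∀ {m c} (pe : Pebble) (p : ℕ) → ValidPos u p →
          (∀ q → ValidPos v q → SamsonWins u v m (place pe p q c)) →
          SamsonWins u v (suc m) c
  moveV : ∀ {m c} (pe : Pebble) (q : ℕ) → ValidPos v q →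
          (∀ p → ValidPos u p → SamsonWins u v m (place pe p q c)) →
          SamsonWins u v (suc m) c

module Submission where

-- Call a pair of positions (i , j) m-distinguishing for (u , v) if Samson
-- wins the m-move game from every valid configuration in which some pebble
-- pair lies on different sides of i in u and of j in v
-- (ord (pebble in u) i ≢ ord (pebble in v) j).  The proof follows the
-- ranker one boundary position at a time:
--   * the starting point of a boundary position (0 for ▷, |w|+1 for ◁)
--     is 0-distinguishing, because no valid pebble is ever separated by it;
--   * if (i' , j') is m-distinguishing and the next boundary position d_a
--     moves i' to i and j' to j, then (i , j) is (m+1)-distinguishing:
--     Samson puts the other pebble on the a at i (in u, or at j in v,
--     by symmetry).  Delilah must answer with an a on the same side of j'
--     as i is of i' (else the other pebble separates (i' , j') and the
--     invariant applies); but then minimality/maximality of the ranker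
--     step forces her answer to be ordered wrongly against the old pebble.
-- Iterating along the ranker gives that (r(u) , r(v)) is n-distinguishing,
-- which is the theorem for the pebble x.

open import Defs
open import Data.Nat using (ℕ; zero; suc; _+_; _∸_; _≤_; _<_; z≤n; s≤s; z<s; s<s)
open import Data.Nat.Properties
  using (_≟_; <-cmp; ≤-refl; ≤-trans; <-irrefl; <-≤-trans; ≤∧≢⇒<; n≤1+n; +-suc; +-identityʳ)
open import Data.Fin using () renaming (_≟_ to _≟ᶠ_)
open import Data.List using (List; []; _∷_; length)
open import Data.Vec using (toList) renaming (_∷_ to _∷ᵥ_)
open import Data.Vec.Properties using (length-toList)
open import Data.Maybe using (Maybe; just; nothing; _>>=_)
open import Data.Bool using (true; false)
open import Data.Product using (Σ; _×_; _,_; proj₁; proj₂)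
open import Data.Sum using (_⊎_; inj₁; inj₂)
open import Data.Empty using (⊥-elim)
open import Relation.Nullary using (Dec; yes; no)
open import Relation.Nullary.Decidable using (map′)
open import Relation.Binary using (tri<; tri≈; tri>)
open import Relation.Binary.PropositionalEquality
  using (_≡_; _≢_; refl; sym; trans; cong; subst; module ≡-Reasoning)

reverseOrd : Ord3 → Ord3
reverseOrd lt = gt
reverseOrd eq = eq
reverseOrd gt = lt

ord-swap : ∀ a b → ord b a ≡ reverseOrd (ord a b)
ord-swap zero    zero    = refl
ord-swap zero    (suc b) = refl
ord-swap (suc a) zero    = refl
ord-swap (suc a) (suc b) = ord-swap a b

ord-lt : ∀ {a b} → a < b → ord a b ≡ lt
ord-lt {zero}  {suc b} z<s     = refl
ord-lt {suc a} {suc b} (s<s h) = ord-lt h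

ord-gt : ∀ {a b} → b < a → ord a b ≡ gt
ord-gt {suc a} {zero}  z<s     = refl
ord-gt {suc a} {suc b} (s<s h) = ord-gt h

ord-lt⁻¹ : ∀ a b → ord a b ≡ lt → a < b
ord-lt⁻¹ zero    (suc b) _ = z<s
ord-lt⁻¹ (suc a) (suc b) h = s<s (ord-lt⁻¹ a b h)
ord-lt⁻¹ zero    zero    ()
ord-lt⁻¹ (suc a) zero    ()

ord-gt⁻¹ : ∀ a b → ord a b ≡ gt → b < a
ord-gt⁻¹ (suc a) zero    _ = z<s
ord-gt⁻¹ (suc a) (suc b) h = s<s (ord-gt⁻¹ a b h)
ord-gt⁻¹ zero    zero    ()
ord-gt⁻¹ zero    (suc b) ()

-- Order types are linearly ranked lt < eq < gt; the rank of ord a b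
-- says how far a lies to the right of b.
rank : Ord3 → ℕ
rank lt = 0
rank eq = 1
rank gt = 2

unrank : ℕ → Ord3
unrank 0 = lt
unrank 1 = eq
unrank _ = gt

unrank-rank : ∀ o → unrank (rank o) ≡ o
unrank-rank lt = refl
unrank-rank eq = refl
unrank-rank gt = refl

rank-injective : ∀ {o o'} → rank o ≡ rank o' → o ≡ o'
rank-injective {o} {o'} h = trans (sym (unrank-rank o)) (trans (cong unrank h) (unrank-rank o'))

rank≤2 : ∀ o → rank o ≤ 2
rank≤2 lt = z≤n
rank≤2 eq = s≤s z≤n
rank≤2 gt = ≤-refl

rank-antitone : ∀ a {b b'} → b ≤ b' → rank (ord a b') ≤ rank (ord a b)
rank-antitone zero    {zero}  {zero}   _         = ≤-refl
rank-antitone zero    {zero}  {suc _}  _         = z≤n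
rank-antitone zero    {suc _} {suc _}  _         = ≤-refl
rank-antitone (suc a) {zero}  {b'}     _         = rank≤2 (ord (suc a) b')
rank-antitone (suc a) {suc b} {suc b'} (s≤s le) = rank-antitone a le

rank-separate : ∀ {o o'} → o ≢ o' → rank o < rank o' ⊎ rank o' < rank o
rank-separate {o} {o'} ne with <-cmp (rank o) (rank o')
... | tri< h _ _ = inj₁ h
... | tri≈ _ e _ = ⊥-elim (ne (rank-injective e))
... | tri> _ _ h = inj₂ h

_≟ₒ_ : (o o' : Ord3) → Dec (o ≡ o')
o ≟ₒ o' = map′ rank-injective (cong rank) (rank o ≟ rank o')

module _ {k : ℕ} where

  at-valid : ∀ (w : Word k) i {a} → at w i ≡ just a → ValidPos w i
  at-valid []      i             ()
  at-valid (b ∷ w) zero          ()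
  at-valid (b ∷ w) (suc zero)    _ = s≤s z≤n , s≤s z≤n
  at-valid (b ∷ w) (suc (suc i)) h = s≤s z≤n , s≤s (proj₂ (at-valid w (suc i) h))

  isA-sound : ∀ (w : Word k) a i → isA w a i ≡ true → at w i ≡ just a
  isA-sound w a i h with at w i
  ... | just b with b ≟ᶠ a
  ...   | yes refl = refl
  isA-sound w a i () | just b | no _
  isA-sound w a i () | nothing

  isA-complete : ∀ (w : Word k) a i → at w i ≡ just a → isA w a i ≡ true
  isA-complete w a i h with at w i
  isA-complete w a i refl | just .a with a ≟ᶠ a
  ... | yes _  = refl
  ... | no a≢a = ⊥-elim (a≢a refl)

false≢true : ∀ {A : Set} → false ≡ true → A
false≢true ()

findUp-least : ∀ P s c {i} → findUp P s c ≡ just i →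
  (s ≤ i) × (P i ≡ true) × (∀ l → s ≤ l → P l ≡ true → i ≤ l)
findUp-least P s zero ()
findUp-least P s (suc c) h with P s in Ps
findUp-least P s (suc c) refl | true = ≤-refl , Ps , λ _ s≤l _ → s≤l
... | false with findUp-least P (suc s) c h
... | s<i , Pi , least = ≤-trans (n≤1+n s) s<i , Pi , least′
  where
  least′ : ∀ l → s ≤ l → P l ≡ true → _
  least′ l s≤l Pl with s ≟ l
  ... | yes refl = false≢true (trans (sym Ps) Pl)
  ... | no s≢l  = least l (≤∧≢⇒< s≤l s≢l) Pl

findDown-greatest : ∀ P m {i} → findDown P m ≡ just i →
  (i ≤ m) × (P i ≡ true) × (∀ l → l ≤ m → P l ≡ true → l ≤ i)
findDown-greatest P zero ()
findDown-greatest P (suc m) h with P (suc m) in Ps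
findDown-greatest P (suc m) refl | true = ≤-refl , Ps , λ _ l≤m _ → l≤m
... | false with findDown-greatest P m h
... | i≤m , Pi , greatest = ≤-trans i≤m (n≤1+n m) , Pi , greatest′
  where
  greatest′ : ∀ l → l ≤ suc m → P l ≡ true → _
  greatest′ l l≤m Pl with l ≟ suc m
  ... | yes refl = false≢true (trans (sym Ps) Pl)
  ... | no l≢m  with ≤∧≢⇒< l≤m l≢m
  ...   | s≤s l≤m′ = greatest l l≤m′ Pl

module _ {k : ℕ} where

  next-spec : ∀ (w : Word k) a q {i} → relB w (▷ , a) q ≡ just i →
    (q < i) × (at w i ≡ just a) × (∀ l → q < l → at w l ≡ just a → i ≤ l)
  next-spec w a q h with findUp-least (isA w a) (suc q) (length w ∸ q) h
  ... | q<i , Pi , least =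
    q<i , isA-sound w a _ Pi , λ l q<l al → least l q<l (isA-complete w a l al)

  prev-spec : ∀ (w : Word k) a q {i} → relB w (◁ , a) q ≡ just i →
    (i < q) × (at w i ≡ just a) × (∀ l → l < q → at w l ≡ just a → l ≤ i)
  prev-spec w a zero ()
  prev-spec w a (suc q) h with findDown-greatest (isA w a) q h
  ... | i≤q , Pi , greatest =
    s≤s i≤q , isA-sound w a _ Pi , λ { l (s≤s l≤q) al → greatest l l≤q (isA-complete w a l al) }

posU posV : Pebble → Config → ℕ
posU pX = xu
posU pY = yu
posV pX = xv
posV pY = yv

other : Pebble → Pebble
other pX = pY
other pY = pX

swapC : Config → Config
swapC c = config (xv c) (yv c) (xu c) (yu c)

placed-separates : ∀ pe p q c {i j} → ord p i ≢ ord q j →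
  ord (posU pe (place pe p q c)) i ≢ ord (posV pe (place pe p q c)) j
placed-separates pX p q c ne = ne
placed-separates pY p q c ne = ne

swap-pebble : ∀ (R : ℕ → ℕ → Set) pe c → R (posU pe c) (posV pe c) →
  R (posV pe (swapC c)) (posU pe (swapC c))
swap-pebble R pX c h = h
swap-pebble R pY c h = h

module _ {k : ℕ} {u v : Word k} where

  valid-posU : ∀ pe {c} → ValidConfig u v c → ValidPos u (posU pe c)
  valid-posU pX (vx , _ , _ , _) = vx
  valid-posU pY (_ , vy , _ , _) = vy

  valid-posV : ∀ pe {c} → ValidConfig u v c → ValidPos v (posV pe c)
  valid-posV pX (_ , _ , vx , _) = vx
  valid-posV pY (_ , _ , _ , vy) = vy

  valid-place : ∀ pe {p q c} → ValidConfig u v c → ValidPos u p → ValidPos v q →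
    ValidConfig u v (place pe p q c)
  valid-place pX (_ , vy , _ , vy') vp vq = vp , vy , vq , vy'
  valid-place pY (vx , _ , vx' , _) vp vq = vx , vp , vx' , vq

  valid-swap : ∀ {c} → ValidConfig u v c → ValidConfig v u (swapC c)
  valid-swap (a , b , c , d) = c , d , a , b

  iso-placed : ∀ pe {p q c} → Iso u v (place (other pe) p q c) →
    (at u p ≡ at v q) × (ord (posU pe c) p ≡ ord (posV pe c) q)
  iso-placed pX (_ , letter , order) = letter , order
  iso-placed pY {p} {q} {c} (letter , _ , order) = letter , order′
    where
    order′ : ord (yu c) p ≡ ord (yv c) q
    order′ = begin
      ord (yu c) p              ≡⟨ ord-swap p (yu c) ⟩
      reverseOrd (ord p (yu c)) ≡⟨ cong reverseOrd order ⟩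
      reverseOrd (ord q (yv c)) ≡⟨ ord-swap q (yv c) ⟨
      ord (yv c) q              ∎
      where open ≡-Reasoning

swap-wins : ∀ {k} {u v : Word k} {m c} → SamsonWins u v m c → SamsonWins v u m (swapC c)
swap-wins (now ¬iso) = now λ { (l₁ , l₂ , o) → ¬iso (sym l₁ , sym l₂ , sym o) }
swap-wins (moveU pX p vp f) = moveV pX p vp λ q vq → swap-wins (f q vq)
swap-wins (moveU pY p vp f) = moveV pY p vp λ q vq → swap-wins (f q vq)
swap-wins (moveV pX q vq f) = moveU pX q vq λ p vp → swap-wins (f p vp)
swap-wins (moveV pY q vq f) = moveU pY q vq λ p vp → swap-wins (f p vp)

module _ {k : ℕ} where

  record Distinguishing (u v : Word k) (m i j : ℕ) : Set where
    constructor distinguishing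
    field
      wins-from : ∀ c → ValidConfig u v c → ∀ pe →
        ord (posU pe c) i ≢ ord (posV pe c) j → SamsonWins u v m c
  open Distinguishing public

  distinguishing-swap : ∀ {u v : Word k} {m i j} →
    Distinguishing u v m i j → Distinguishing v u m j i
  distinguishing-swap {u} {v} {i = i} {j} D = distinguishing λ c vc pe ne →
    swap-wins (wins-from D (swapC c) (valid-swap {u = v} {v = u} vc) pe
      λ e → swap-pebble (λ x y → ord x j ≢ ord y i) pe c ne (sym e))

  origin : Word k → Boundary k → ℕ
  origin w (▷ , _) = 0
  origin w (◁ , _) = suc (length w)

  absB-origin : ∀ (w : Word k) p → absB w p ≡ relB w p (origin w p)
  absB-origin w (▷ , a) = refl
  absB-origin w (◁ , a) = refl

  evalRanker-from-origin : ∀ {n} p (ps : Ranker k n) (w : Word k) →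
    evalRanker w (p ∷ᵥ ps) ≡ evalFrom w (origin w p) (p ∷ toList ps)
  evalRanker-from-origin p ps w =
    cong (λ mq → mq >>= λ q → evalFrom w q (toList ps)) (absB-origin w p)

  -- No valid pebble is separated by the origins, so they distinguish
  -- vacuously.
  origin-distinguishing : ∀ {u v : Word k} p → Distinguishing u v 0 (origin u p) (origin v p)
  origin-distinguishing {u} {v} (▷ , _) = distinguishing λ c vc pe ne →
    ⊥-elim (ne (trans (ord-gt (proj₁ (valid-posU {u = u} {v = v} pe vc)))
                      (sym (ord-gt (proj₁ (valid-posV {u = u} {v = v} pe vc))))))
  origin-distinguishing {u} {v} (◁ , _) = distinguishing λ c vc pe ne →
    ⊥-elim (ne (trans (ord-lt (s≤s (proj₂ (valid-posU {u = u} {v = v} pe vc))))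
                      (sym (ord-lt (s≤s (proj₂ (valid-posV {u = u} {v = v} pe vc)))))))

  -- Samson's move: put the other pair on p in u.  Every answer q of Delilah
  -- either separates (i' , j') with that pair, or is refuted outright.
  place-in-u : ∀ {u v : Word k} {m i' j'} → Distinguishing u v m i' j' →
    ∀ c → ValidConfig u v c → ∀ pe p → ValidPos u p →
    (∀ q → Iso u v (place (other pe) p q c) → ord p i' ≢ ord q j') →
    SamsonWins u v (suc m) c
  place-in-u {u} {v} {i' = i'} {j'} D c vc pe p vp refute =
    moveU (other pe) p vp answer
    where
    answer : ∀ q → ValidPos v q → SamsonWins u v _ (place (other pe) p q c)
    answer q vq with ord p i' ≟ₒ ord q j'
    ... | yes same = now λ iso → refute q iso same
    ... | no differ = wins-from D _ (valid-place {u = u} {v = v} (other pe) vc vp vq) (other pe)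
                          (placed-separates (other pe) p q c {i'} {j'} differ)

  -- One ▷_a step, when the pebble in u is the one further right:
  -- Samson marks the a at i; an answer after j' lies at or after j,
  -- which is ordered too far left against the old pebble.
  step-next : ∀ {u v : Word k} {m a i' j' i j} →
    relB u (▷ , a) i' ≡ just i → relB v (▷ , a) j' ≡ just j →
    Distinguishing u v m i' j' → ∀ c → ValidConfig u v c → ∀ pe →
    rank (ord (posV pe c) j) < rank (ord (posU pe c) i) → SamsonWins u v (suc m) c
  step-next {u} {v} {a = a} {i'} {j'} {i} {j} hi hj D c vc pe gap
    with next-spec u a i' hi | next-spec v a j' hj
  ... | i'<i , ai , _ | _ , _ , first-j = place-in-u D c vc pe i (at-valid u i ai) refute
    where
    refute : ∀ q → Iso u v (place (other pe) i q c) → ord i i' ≢ ord q j'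
    refute q iso same with iso-placed {u = u} {v = v} pe iso
    ... | letter , order = <-irrefl refl (<-≤-trans gap too-far)
      where
      j≤q : j ≤ q
      j≤q = first-j q (ord-gt⁻¹ q j' (trans (sym same) (ord-gt i'<i))) (trans (sym letter) ai)
      too-far : rank (ord (posU pe c) i) ≤ rank (ord (posV pe c) j)
      too-far = subst (λ o → rank o ≤ _) (sym order) (rank-antitone (posV pe c) j≤q)

  step-prev : ∀ {u v : Word k} {m a i' j' i j} →
    relB u (◁ , a) i' ≡ just i → relB v (◁ , a) j' ≡ just j →
    Distinguishing u v m i' j' → ∀ c → ValidConfig u v c → ∀ pe →
    rank (ord (posU pe c) i) < rank (ord (posV pe c) j) → SamsonWins u v (suc m) c
  step-prev {u} {v} {a = a} {i'} {j'} {i} {j} hi hj D c vc pe gap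
    with prev-spec u a i' hi | prev-spec v a j' hj
  ... | i<i' , ai , _ | _ , _ , last-j = place-in-u D c vc pe i (at-valid u i ai) refute
    where
    refute : ∀ q → Iso u v (place (other pe) i q c) → ord i i' ≢ ord q j'
    refute q iso same with iso-placed {u = u} {v = v} pe iso
    ... | letter , order = <-irrefl refl (<-≤-trans gap too-far)
      where
      q≤j : q ≤ j
      q≤j = last-j q (ord-lt⁻¹ q j' (trans (sym same) (ord-lt i<i'))) (trans (sym letter) ai)
      too-far : rank (ord (posV pe c) j) ≤ rank (ord (posU pe c) i)
      too-far = subst (λ o → _ ≤ rank o) (sym order) (rank-antitone (posV pe c) q≤j)

  -- A boundary position step turns an m-distinguishing pair into an
  -- (m+1)-distinguishing one; the two wrong-way cases are the mirror image.
  step : ∀ {u v : Word k} {m} b {i' j' i j} →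
    relB u b i' ≡ just i → relB v b j' ≡ just j →
    Distinguishing u v m i' j' → Distinguishing u v (suc m) i j
  step b hi hj D = distinguishing (step-wins b hi hj D)
    where
    step-wins : ∀ {u v : Word k} {m} b {i' j' i j} →
      relB u b i' ≡ just i → relB v b j' ≡ just j → Distinguishing u v m i' j' →
      ∀ c → ValidConfig u v c → ∀ pe → ord (posU pe c) i ≢ ord (posV pe c) j →
      SamsonWins u v (suc m) c
    step-wins {u} {v} (d , a) {i = i} {j} hi hj D c vc pe ne with d | rank-separate ne
    ... | ▷ | inj₂ gap = step-next hi hj D c vc pe gap
    ... | ◁ | inj₁ gap = step-prev hi hj D c vc pe gap
    ... | ▷ | inj₁ gap = swap-wins (step-next hj hi (distinguishing-swap D) (swapC c)
        (valid-swap {u = u} {v = v} vc) pe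
        (swap-pebble (λ x y → rank (ord x i) < rank (ord y j)) pe c gap))
    ... | ◁ | inj₂ gap = swap-wins (step-prev hj hi (distinguishing-swap D) (swapC c)
        (valid-swap {u = u} {v = v} vc) pe
        (swap-pebble (λ x y → rank (ord y j) < rank (ord x i)) pe c gap))

bind-just : ∀ {A B : Set} (mx : Maybe A) (f : A → Maybe B) {y} → (mx >>= f) ≡ just y →
  Σ A λ x → (mx ≡ just x) × (f x ≡ just y)
bind-just (just x) f h = x , refl , h
bind-just nothing  f ()

module _ {k : ℕ} {u v : Word k} where

  distinguishing-along : ∀ (L : List (Boundary k)) {m s t i j} →
    Distinguishing u v m s t →
    evalFrom u s L ≡ just i → evalFrom v t L ≡ just j →
    Distinguishing u v (m + length L) i j
  distinguishing-along [] {m} {s} {t} D refl refl =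
    subst (λ n → Distinguishing u v n s t) (sym (+-identityʳ m)) D
  distinguishing-along (p ∷ L) {m} {s} {t} {i} {j} D hi hj
    with bind-just (relB u p s) _ hi | bind-just (relB v p t) _ hj
  ... | s' , hs , hi' | t' , ht , hj' =
    subst (λ n → Distinguishing u v n i j) (sym (+-suc m (length L)))
      (distinguishing-along L (step p hs ht D) hi' hj')

lemma3p5 : ∀ {k : ℕ} (n : ℕ) → 0 < n → (u v : Word k) (r : Ranker k n) (i j : ℕ) →
    evalRanker u r ≡ just i → evalRanker v r ≡ just j →
    (c : Config) → ValidConfig u v c →
    ord (xu c) i ≢ ord (xv c) j →
    SamsonWins u v n c
lemma3p5 (suc n) _ u v (p ∷ᵥ ps) i j hi hj c vc ne =
  subst (λ m → SamsonWins u v m c) (cong suc (length-toList ps))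
    (wins-from ranker-distinguishes c vc pX ne)
  where
  ranker-distinguishes : Distinguishing u v (suc (length (toList ps))) i j
  ranker-distinguishes =
    distinguishing-along {u = u} {v = v} (p ∷ toList ps)
      (origin-distinguishing {u = u} {v = v} p)
      (trans (sym (evalRanker-from-origin p ps u)) hi)
      (trans (sym (evalRanker-from-origin p ps v)) hj)
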